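{- For every integer $m$ and every positive integer $n$, \[ \sum_{j=1}^n\binom{n}{j}\Big\lfloor\frac{j}{2}\Big\rfloor F_{j+m}=\frac n2F_{2n+m-1}-\frac14\big(F_{2n+m}+(-1)^mF_{n-m}\big) \] and \[ \sum_{j=1}^n\binom{n}{j}\Big\lfloor\frac{j}{2}\Big\rfloor L_{j+m}=\frac n2L_{2n+m-1}-\frac14\big(L_{2n+m}-(-1)^mL_{n-m}\big). \]
   Context: $F_n$ and $L_n$ are the Fibonacci and Lucas numbers ($F_0=0,F_1=1$, $L_0=2,L_1=1$, $X_n=X_{n-1}+X_{n-2}$), extended to negative indices by $F_{ -n}=(-1)^{n-1}F_n$, $L_{ -n}=(-1)^nL_n$. $\lfloor x\rfloor$ is the floor function. -}

module Defs where

open import Data.Nat as ℕ using (ℕ; zero; suc)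
open import Data.Nat.Combinatorics using (_C_)
open import Data.Integer using (ℤ; +_; -[1+_]; _+_; _*_; -_)

fibℕ : ℕ → ℤ
fibℕ zero = + 0
fibℕ (suc zero) = + 1
fibℕ (suc (suc n)) = fibℕ (suc n) + fibℕ n

lucℕ : ℕ → ℤ
lucℕ zero = + 2
lucℕ (suc zero) = + 1
lucℕ (suc (suc n)) = lucℕ (suc n) + lucℕ n

sgn : ℕ → ℤ
sgn zero = + 1
sgn (suc n) = - sgn n

sgnℤ : ℤ → ℤ
sgnℤ (+ n) = sgn n
sgnℤ -[1+ n ] = sgn (suc n)

-- Extension to negative indices: F_{-n} = (-1)^{n-1} F_n, L_{-n} = (-1)^n L_n
F : ℤ → ℤ
F (+ n) = fibℕ n
F -[1+ n ] = sgn n * fibℕ (suc n)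

L : ℤ → ℤ
L (+ n) = lucℕ n
L -[1+ n ] = sgn (suc n) * lucℕ (suc n)

sumFrom1 : ℕ → (ℕ → ℤ) → ℤ
sumFrom1 zero f = + 0
sumFrom1 (suc n) f = sumFrom1 n f + f (suc n)

{-# OPTIONS --safe #-}
module Submission where

-- Since 4⌊j/2⌋ = 2j − 1 + (−1)^j, four times the sum is a combination of three binomial
-- transforms of a sequence G with G(k+2) = G(k+1) + G(k):
--   Σ_j C(n,j) G(j+m) = G(2n+m),   Σ_j C(n,j) j G(j+m) = n G(2n+m−1),
--   Σ_j C(n,j) (−1)^j G(j+m) = (−1)^n G(m−n),
-- each proved by induction on n through Pascal's rule. The reflections
-- F(−k) = −(−1)^k F(k) and L(−k) = (−1)^k L(k) turn (−1)^n G(m−n) into ∓(−1)^m G(n−m).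

open import Defs
open import Data.Nat as ℕ using (ℕ; suc; zero; _/_)
open import Data.Nat.Combinatorics using (_C_; nCk+nC[k+1]≡[n+1]C[k+1]; k>n⇒nCk≡0)
open import Data.Integer using (ℤ; +_; -[1+_]; _+_; _-_; _*_; -_)
open import Data.Product using (_×_; _,_)
open import Relation.Binary.PropositionalEquality
open import Data.Integer.Tactic.RingSolver using (solve-∀)
import Data.Integer.Properties as ℤ
import Data.Nat.Properties as ℕ
open import Data.Nat.DivMod using (m/n≡1+[m∸n]/n)
open ≡-Reasoning

sumTo : ℕ → (ℕ → ℤ) → ℤ
sumTo zero f = f 0
sumTo (suc n) f = f 0 + sumTo n (λ j → f (suc j))

sumTo-cong : ∀ n {f g : ℕ → ℤ} → (∀ j → f j ≡ g j) → sumTo n f ≡ sumTo n g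
sumTo-cong zero f≡g = f≡g 0
sumTo-cong (suc n) f≡g = cong₂ _+_ (f≡g 0) (sumTo-cong n (λ j → f≡g (suc j)))

sumTo-+ : ∀ n (f g : ℕ → ℤ) → sumTo n (λ j → f j + g j) ≡ sumTo n f + sumTo n g
sumTo-+ zero f g = refl
sumTo-+ (suc n) f g = begin
  f 0 + g 0 + sumTo n (λ j → f (suc j) + g (suc j))
    ≡⟨ cong (λ s → f 0 + g 0 + s) (sumTo-+ n (λ j → f (suc j)) (λ j → g (suc j))) ⟩
  f 0 + g 0 + (sumTo n (λ j → f (suc j)) + sumTo n (λ j → g (suc j)))
    ≡⟨ interchange (f 0) (g 0) _ _ ⟩
  f 0 + sumTo n (λ j → f (suc j)) + (g 0 + sumTo n (λ j → g (suc j))) ∎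
  where
  interchange : ∀ a b x y → a + b + (x + y) ≡ a + x + (b + y)
  interchange = solve-∀

sumTo-*ˡ : ∀ n a (f : ℕ → ℤ) → sumTo n (λ j → a * f j) ≡ a * sumTo n f
sumTo-*ˡ zero a f = refl
sumTo-*ˡ (suc n) a f = begin
  a * f 0 + sumTo n (λ j → a * f (suc j)) ≡⟨ cong (λ s → a * f 0 + s) (sumTo-*ˡ n a (λ j → f (suc j))) ⟩
  a * f 0 + a * sumTo n (λ j → f (suc j)) ≡⟨ ℤ.*-distribˡ-+ a (f 0) _ ⟨
  a * (f 0 + sumTo n (λ j → f (suc j))) ∎

sumTo-suc : ∀ n (f : ℕ → ℤ) → sumTo (suc n) f ≡ sumTo n f + f (suc n)
sumTo-suc zero f = refl
sumTo-suc (suc n) f = begin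
  f 0 + sumTo (suc n) (λ j → f (suc j)) ≡⟨ cong (λ s → f 0 + s) (sumTo-suc n (λ j → f (suc j))) ⟩
  f 0 + (sumTo n (λ j → f (suc j)) + f (suc (suc n))) ≡⟨ ℤ.+-assoc (f 0) _ _ ⟨
  f 0 + sumTo n (λ j → f (suc j)) + f (suc (suc n)) ∎

sumTo≡f0+sumFrom1 : ∀ n (f : ℕ → ℤ) → sumTo n f ≡ f 0 + sumFrom1 n f
sumTo≡f0+sumFrom1 zero f = sym (ℤ.+-identityʳ (f 0))
sumTo≡f0+sumFrom1 (suc n) f = begin
  sumTo (suc n) f                 ≡⟨ sumTo-suc n f ⟩
  sumTo n f + f (suc n)           ≡⟨ cong (_+ f (suc n)) (sumTo≡f0+sumFrom1 n f) ⟩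
  f 0 + sumFrom1 n f + f (suc n)  ≡⟨ ℤ.+-assoc (f 0) _ _ ⟩
  f 0 + sumFrom1 (suc n) f        ∎

binomialSum : ℕ → (ℕ → ℤ) → ℤ
binomialSum n h = sumTo n (λ j → + (n C j) * h j)

binomialSum-cong : ∀ n {g h : ℕ → ℤ} → (∀ j → g j ≡ h j) → binomialSum n g ≡ binomialSum n h
binomialSum-cong n g≡h = sumTo-cong n (λ j → cong (+ (n C j) *_) (g≡h j))

binomialSum-+ : ∀ n (g h : ℕ → ℤ) → binomialSum n (λ j → g j + h j) ≡ binomialSum n g + binomialSum n h
binomialSum-+ n g h =
  trans (sumTo-cong n (λ j → ℤ.*-distribˡ-+ (+ (n C j)) (g j) (h j))) (sumTo-+ n _ _)

binomialSum-*ˡ : ∀ n a (h : ℕ → ℤ) → binomialSum n (λ j → a * h j) ≡ a * binomialSum n h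
binomialSum-*ˡ n a h = trans (sumTo-cong n (λ j → swap (+ (n C j)) a (h j))) (sumTo-*ˡ n a _)
  where
  swap : ∀ c a x → c * (a * x) ≡ a * (c * x)
  swap = solve-∀

binomialSum-suc : ∀ n h → binomialSum (suc n) h ≡ binomialSum n h + binomialSum n (λ j → h (suc j))
binomialSum-suc n h = begin
  + 1 * h 0 + sumTo n (λ j → + (suc n C suc j) * h (suc j))
    ≡⟨ cong₂ _+_ (ℤ.*-identityˡ (h 0)) (sumTo-cong n pascal) ⟩
  h 0 + sumTo n (λ j → + (n C j) * h (suc j) + + (n C suc j) * h (suc j))
    ≡⟨ cong (λ s → h 0 + s) (sumTo-+ n _ _) ⟩
  h 0 + (binomialSum n (λ j → h (suc j)) + tail)
    ≡⟨ rearrange (h 0) _ _ ⟩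
  (h 0 + tail) + binomialSum n (λ j → h (suc j))
    ≡⟨ cong (_+ binomialSum n (λ j → h (suc j))) head+tail ⟨
  binomialSum n h + binomialSum n (λ j → h (suc j)) ∎
  where
  tail : ℤ
  tail = sumTo n (λ j → + (n C suc j) * h (suc j))

  pascal : ∀ j → + (suc n C suc j) * h (suc j) ≡ + (n C j) * h (suc j) + + (n C suc j) * h (suc j)
  pascal j = begin
    + (suc n C suc j) * h (suc j)               ≡⟨ cong (λ c → + c * h (suc j)) (nCk+nC[k+1]≡[n+1]C[k+1] n j) ⟨
    + (n C j ℕ.+ n C suc j) * h (suc j)         ≡⟨ ℤ.*-distribʳ-+ (h (suc j)) (+ (n C j)) (+ (n C suc j)) ⟩
    + (n C j) * h (suc j) + + (n C suc j) * h (suc j) ∎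

  -- append the vanishing term C(n, n+1) h(n+1) so that sumTo unfolds at the front
  head+tail : binomialSum n h ≡ h 0 + tail
  head+tail = begin
    binomialSum n h                                  ≡⟨ ℤ.+-identityʳ _ ⟨
    binomialSum n h + + 0                            ≡⟨ cong (λ c → binomialSum n h + + c * h (suc n)) (k>n⇒nCk≡0 (ℕ.n<1+n n)) ⟨
    binomialSum n h + + (n C suc n) * h (suc n)      ≡⟨ sumTo-suc n (λ j → + (n C j) * h j) ⟨
    + 1 * h 0 + tail                                 ≡⟨ cong (_+ tail) (ℤ.*-identityˡ (h 0)) ⟩
    h 0 + tail                                       ∎

  rearrange : ∀ a b c → a + (b + c) ≡ (a + c) + b
  rearrange = solve-∀

sgn-suc-suc : ∀ j → sgn (suc (suc j)) ≡ sgn j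
sgn-suc-suc j = ℤ.neg-involutive (sgn j)

sgn*sgn≡1 : ∀ n → sgn n * sgn n ≡ + 1
sgn*sgn≡1 zero = refl
sgn*sgn≡1 (suc n) = trans (neg*neg (sgn n)) (sgn*sgn≡1 n)
  where
  neg*neg : ∀ s → - s * - s ≡ s * s
  neg*neg = solve-∀

4*[j/2]≡2*j-1+sgn-j : ∀ j → + 4 * + (j / 2) ≡ + 2 * + j - + 1 + sgn j
4*[j/2]≡2*j-1+sgn-j zero = refl
4*[j/2]≡2*j-1+sgn-j (suc zero) = refl
4*[j/2]≡2*j-1+sgn-j (suc (suc j)) = begin
  + 4 * + (suc (suc j) / 2)           ≡⟨ cong (λ q → + 4 * + q) (m/n≡1+[m∸n]/n {suc (suc j)} {2} (ℕ.s≤s (ℕ.s≤s ℕ.z≤n))) ⟩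
  + 4 * (+ 1 + + (j / 2))             ≡⟨ ℤ.*-distribˡ-+ (+ 4) (+ 1) (+ (j / 2)) ⟩
  + 4 + + 4 * + (j / 2)               ≡⟨ cong (λ s → + 4 + s) (4*[j/2]≡2*j-1+sgn-j j) ⟩
  + 4 + (+ 2 * + j - + 1 + sgn j)     ≡⟨ shift (+ j) (sgn j) ⟩
  + 2 * (+ 2 + + j) - + 1 + sgn j     ≡⟨ cong (λ s → + 2 * (+ 2 + + j) - + 1 + s) (sgn-suc-suc j) ⟨
  + 2 * (+ 2 + + j) - + 1 + sgn (suc (suc j)) ∎
  where
  shift : ∀ a s → + 4 + (+ 2 * a - + 1 + s) ≡ + 2 * (+ 2 + a) - + 1 + s
  shift = solve-∀

module FibonacciLike (G : ℤ → ℤ) (G-rec : ∀ k → G (k + + 2) ≡ G (k + + 1) + G k) where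

  G-suc : ∀ j m → G (+ suc j + m) ≡ G (+ j + (m + + 1))
  G-suc j m = cong G (move-1 (+ j) m)
    where
    move-1 : ∀ j m → + 1 + j + m ≡ j + (m + + 1)
    move-1 = solve-∀

  binomialSum-G : ∀ n m → binomialSum n (λ j → G (+ j + m)) ≡ G (+ 2 * + n + m)
  binomialSum-G zero m = ℤ.*-identityˡ _
  binomialSum-G (suc n) m = begin
    binomialSum (suc n) (λ j → G (+ j + m))
      ≡⟨ binomialSum-suc n _ ⟩
    binomialSum n (λ j → G (+ j + m)) + binomialSum n (λ j → G (+ 1 + + j + m))
      ≡⟨ cong₂ _+_ (binomialSum-G n m)
           (trans (binomialSum-cong n (λ j → G-suc j m)) (binomialSum-G n (m + + 1))) ⟩
    G k + G (+ 2 * + n + (m + + 1))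
      ≡⟨ cong (λ i → G k + G i) (ℤ.+-assoc (+ 2 * + n) m (+ 1)) ⟨
    G k + G (k + + 1)
      ≡⟨ ℤ.+-comm (G k) _ ⟩
    G (k + + 1) + G k
      ≡⟨ G-rec k ⟨
    G (k + + 2)
      ≡⟨ cong G (next (+ n) m) ⟩
    G (+ 2 * (+ 1 + + n) + m) ∎
    where
    k = + 2 * + n + m
    next : ∀ n m → + 2 * n + m + + 2 ≡ + 2 * (+ 1 + n) + m
    next = solve-∀

  binomialSum-jG : ∀ n m → binomialSum n (λ j → + j * G (+ j + m)) ≡ + n * G (+ 2 * + n + m - + 1)
  binomialSum-jG zero m = refl
  binomialSum-jG (suc n) m = begin
    binomialSum (suc n) (λ j → + j * G (+ j + m))
      ≡⟨ binomialSum-suc n _ ⟩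
    binomialSum n (λ j → + j * G (+ j + m)) + binomialSum n (λ j → + suc j * G (+ suc j + m))
      ≡⟨ cong (λ s → binomialSum n (λ j → + j * G (+ j + m)) + s)
           (trans (binomialSum-cong n split) (binomialSum-+ n _ _)) ⟩
    binomialSum n (λ j → + j * G (+ j + m))
      + (binomialSum n (λ j → + j * G (+ j + (m + + 1))) + binomialSum n (λ j → G (+ j + (m + + 1))))
      ≡⟨ cong₂ _+_ (binomialSum-jG n m) (cong₂ _+_ (binomialSum-jG n (m + + 1)) (binomialSum-G n (m + + 1))) ⟩
    + n * G k + (+ n * G (+ 2 * + n + (m + + 1) - + 1) + G (+ 2 * + n + (m + + 1)))
      ≡⟨ cong₂ (λ a b → + n * G k + (+ n * G a + G b)) (k+1 (+ n) m) (k+2 (+ n) m) ⟩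
    + n * G k + (+ n * G (k + + 1) + G (k + + 2))
      ≡⟨ cong (λ s → + n * G k + (+ n * G (k + + 1) + s)) (G-rec k) ⟩
    + n * G k + (+ n * G (k + + 1) + (G (k + + 1) + G k))
      ≡⟨ collect (+ n) (G k) (G (k + + 1)) ⟩
    (+ 1 + + n) * (G (k + + 1) + G k)
      ≡⟨ cong ((+ 1 + + n) *_) (G-rec k) ⟨
    (+ 1 + + n) * G (k + + 2)
      ≡⟨ cong (λ i → (+ 1 + + n) * G i) (next (+ n) m) ⟩
    + suc n * G (+ 2 * + suc n + m - + 1) ∎
    where
    k = + 2 * + n + m - + 1
    split : ∀ j → + suc j * G (+ suc j + m) ≡ + j * G (+ j + (m + + 1)) + G (+ j + (m + + 1))
    split j = trans (cong (+ suc j *_) (G-suc j m)) (suc* (+ j) _)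
      where
      suc* : ∀ j x → (+ 1 + j) * x ≡ j * x + x
      suc* = solve-∀
    k+1 : ∀ n m → + 2 * n + (m + + 1) - + 1 ≡ + 2 * n + m - + 1 + + 1
    k+1 = solve-∀
    k+2 : ∀ n m → + 2 * n + (m + + 1) ≡ + 2 * n + m - + 1 + + 2
    k+2 = solve-∀
    collect : ∀ a x y → a * x + (a * y + (y + x)) ≡ (+ 1 + a) * (y + x)
    collect = solve-∀
    next : ∀ n m → + 2 * n + m - + 1 + + 2 ≡ + 2 * (+ 1 + n) + m - + 1
    next = solve-∀

  binomialSum-sgnG : ∀ n m → binomialSum n (λ j → sgn j * G (+ j + m)) ≡ sgn n * G (m - + n)
  binomialSum-sgnG zero m = begin
    + 1 * (+ 1 * G (+ 0 + m)) ≡⟨ ℤ.*-identityˡ _ ⟩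
    + 1 * G (+ 0 + m)         ≡⟨ cong (+ 1 *_) (cong G (trans (ℤ.+-identityˡ m) (sym (ℤ.+-identityʳ m)))) ⟩
    + 1 * G (m - + 0)         ∎
  binomialSum-sgnG (suc n) m = begin
    binomialSum (suc n) (λ j → sgn j * G (+ j + m))
      ≡⟨ binomialSum-suc n _ ⟩
    binomialSum n (λ j → sgn j * G (+ j + m)) + binomialSum n (λ j → - sgn j * G (+ suc j + m))
      ≡⟨ cong (λ s → binomialSum n (λ j → sgn j * G (+ j + m)) + s)
           (trans (binomialSum-cong n negate) (binomialSum-*ˡ n (- + 1) _)) ⟩
    binomialSum n (λ j → sgn j * G (+ j + m)) + - + 1 * binomialSum n (λ j → sgn j * G (+ j + (m + + 1)))
      ≡⟨ cong₂ (λ a b → a + - + 1 * b) (binomialSum-sgnG n m) (binomialSum-sgnG n (m + + 1)) ⟩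
    sgn n * G (m - + n) + - + 1 * (sgn n * G (m + + 1 - + n))
      ≡⟨ cong₂ (λ a b → sgn n * G a + - + 1 * (sgn n * G b)) (k+1 m (+ n)) (k+2 m (+ n)) ⟩
    sgn n * G (k + + 1) + - + 1 * (sgn n * G (k + + 2))
      ≡⟨ cong (λ s → sgn n * G (k + + 1) + - + 1 * (sgn n * s)) (G-rec k) ⟩
    sgn n * G (k + + 1) + - + 1 * (sgn n * (G (k + + 1) + G k))
      ≡⟨ cancel (sgn n) _ _ ⟩
    - sgn n * G k
      ≡⟨ cong (λ i → - sgn n * G i) (k≡ m (+ n)) ⟩
    sgn (suc n) * G (m - + suc n) ∎
    where
    k = m - + n - + 1
    negate : ∀ j → - sgn j * G (+ suc j + m) ≡ - + 1 * (sgn j * G (+ j + (m + + 1)))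
    negate j = trans (cong (- sgn j *_) (G-suc j m)) (neg≡-1* (sgn j) _)
      where
      neg≡-1* : ∀ s x → - s * x ≡ - + 1 * (s * x)
      neg≡-1* = solve-∀
    k+1 : ∀ m n → m - n ≡ m - n - + 1 + + 1
    k+1 = solve-∀
    k+2 : ∀ m n → m + + 1 - n ≡ m - n - + 1 + + 2
    k+2 = solve-∀
    cancel : ∀ s x y → s * x + - + 1 * (s * (x + y)) ≡ - s * y
    cancel = solve-∀
    k≡ : ∀ m n → m - n - + 1 ≡ m - (+ 1 + n)
    k≡ = solve-∀

  4*sumFrom1-floorHalf : ∀ m n →
    + 4 * sumFrom1 n (λ j → + ((n C j) ℕ.* (j / 2)) * G (+ j + m))
      ≡ + 2 * + n * G (+ 2 * + n + m - + 1) - G (+ 2 * + n + m) + sgn n * G (m - + n)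
  4*sumFrom1-floorHalf m n = begin
    + 4 * sumFrom1 n f
      ≡⟨ cong (+ 4 *_) (trans (sumTo≡f0+sumFrom1 n f) (ℤ.+-identityˡ _)) ⟨
    + 4 * sumTo n f
      ≡⟨ sumTo-*ˡ n (+ 4) f ⟨
    sumTo n (λ j → + 4 * f j)
      ≡⟨ sumTo-cong n quadruple ⟩
    binomialSum n (λ j → + 2 * (+ j * g j) + - + 1 * g j + sgn j * g j)
      ≡⟨ trans (binomialSum-+ n _ _) (cong (_+ B) (binomialSum-+ n _ _)) ⟩
    binomialSum n (λ j → + 2 * (+ j * g j)) + binomialSum n (λ j → - + 1 * g j) + B
      ≡⟨ cong₂ (λ a b → a + b + B) (binomialSum-*ˡ n (+ 2) _) (binomialSum-*ˡ n (- + 1) _) ⟩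
    + 2 * binomialSum n (λ j → + j * g j) + - + 1 * binomialSum n g + B
      ≡⟨ cong₂ (λ a b → + 2 * a + - + 1 * b + B) (binomialSum-jG n m) (binomialSum-G n m) ⟩
    + 2 * (+ n * G (+ 2 * + n + m - + 1)) + - + 1 * G (+ 2 * + n + m) + B
      ≡⟨ cong₂ _+_ (tidy (+ n) _ _) (binomialSum-sgnG n m) ⟩
    + 2 * + n * G (+ 2 * + n + m - + 1) - G (+ 2 * + n + m) + sgn n * G (m - + n) ∎
    where
    g : ℕ → ℤ
    g j = G (+ j + m)
    f : ℕ → ℤ
    f j = + ((n C j) ℕ.* (j / 2)) * g j
    B : ℤ
    B = binomialSum n (λ j → sgn j * g j)

    quadruple : ∀ j → + 4 * f j ≡ + (n C j) * (+ 2 * (+ j * g j) + - + 1 * g j + sgn j * g j)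
    quadruple j = begin
      + 4 * (+ ((n C j) ℕ.* (j / 2)) * g j)    ≡⟨ cong (λ c → + 4 * (c * g j)) (ℤ.pos-* (n C j) (j / 2)) ⟩
      + 4 * (+ (n C j) * + (j / 2) * g j)      ≡⟨ reassoc (+ (n C j)) (+ (j / 2)) (g j) ⟩
      + (n C j) * ((+ 4 * + (j / 2)) * g j)    ≡⟨ cong (λ c → + (n C j) * (c * g j)) (4*[j/2]≡2*j-1+sgn-j j) ⟩
      + (n C j) * ((+ 2 * + j - + 1 + sgn j) * g j) ≡⟨ expand (+ (n C j)) (+ j) (sgn j) (g j) ⟩
      + (n C j) * (+ 2 * (+ j * g j) + - + 1 * g j + sgn j * g j) ∎
      where
      reassoc : ∀ c h x → + 4 * (c * h * x) ≡ c * ((+ 4 * h) * x)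
      reassoc = solve-∀
      expand : ∀ c t s x → c * ((+ 2 * t - + 1 + s) * x) ≡ c * (+ 2 * (t * x) + - + 1 * x + s * x)
      expand = solve-∀

    tidy : ∀ a x y → + 2 * (a * x) + - + 1 * y ≡ + 2 * a * x - y
    tidy = solve-∀

sgnℤ-neg : ∀ k → sgnℤ (- k) ≡ sgnℤ k
sgnℤ-neg (+ zero) = refl
sgnℤ-neg (+ suc n) = refl
sgnℤ-neg -[1+ n ] = refl

sgnℤ-suc : ∀ k → sgnℤ (k + + 1) ≡ - sgnℤ k
sgnℤ-suc (+ n) = cong sgn (ℕ.+-comm n 1)
sgnℤ-suc -[1+ zero ] = refl
sgnℤ-suc -[1+ suc p ] = sym (sgn-suc-suc (suc p))

sgnℤ[n-m]≡sgn-n*sgnℤ-m : ∀ n m → sgnℤ (+ n - m) ≡ sgn n * sgnℤ m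
sgnℤ[n-m]≡sgn-n*sgnℤ-m zero m = begin
  sgnℤ (+ 0 - m)   ≡⟨ cong sgnℤ (ℤ.+-identityˡ (- m)) ⟩
  sgnℤ (- m)       ≡⟨ sgnℤ-neg m ⟩
  sgnℤ m           ≡⟨ ℤ.*-identityˡ (sgnℤ m) ⟨
  + 1 * sgnℤ m     ∎
sgnℤ[n-m]≡sgn-n*sgnℤ-m (suc n) m = begin
  sgnℤ (+ suc n - m)          ≡⟨ cong sgnℤ (suc-minus (+ n) m) ⟩
  sgnℤ (+ n - m + + 1)        ≡⟨ sgnℤ-suc (+ n - m) ⟩
  - sgnℤ (+ n - m)            ≡⟨ cong -_ (sgnℤ[n-m]≡sgn-n*sgnℤ-m n m) ⟩
  - (sgn n * sgnℤ m)          ≡⟨ ℤ.neg-distribˡ-* (sgn n) (sgnℤ m) ⟩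
  sgn (suc n) * sgnℤ m        ∎
  where
  suc-minus : ∀ n m → + 1 + n - m ≡ n - m + + 1
  suc-minus = solve-∀

reflect-index : (G : ℤ → ℤ) (c : ℤ) → (∀ k → G (- k) ≡ c * (sgnℤ k * G k)) →
                ∀ n m → sgn n * G (m - + n) ≡ c * (sgnℤ m * G (+ n - m))
reflect-index G c G-neg n m = begin
  sgn n * G (m - + n)                        ≡⟨ cong (λ i → sgn n * G i) (flip m (+ n)) ⟩
  sgn n * G (- (+ n - m))                    ≡⟨ cong (sgn n *_) (G-neg (+ n - m)) ⟩
  sgn n * (c * (sgnℤ (+ n - m) * G (+ n - m))) ≡⟨ cong (λ s → sgn n * (c * (s * G (+ n - m)))) (sgnℤ[n-m]≡sgn-n*sgnℤ-m n m) ⟩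
  sgn n * (c * (sgn n * sgnℤ m * G (+ n - m))) ≡⟨ regroup (sgn n) c (sgnℤ m) _ ⟩
  sgn n * sgn n * (c * (sgnℤ m * G (+ n - m))) ≡⟨ cong (_* (c * (sgnℤ m * G (+ n - m)))) (sgn*sgn≡1 n) ⟩
  + 1 * (c * (sgnℤ m * G (+ n - m)))         ≡⟨ ℤ.*-identityˡ _ ⟩
  c * (sgnℤ m * G (+ n - m))                 ∎
  where
  flip : ∀ m n → m - n ≡ - (n - m)
  flip = solve-∀
  regroup : ∀ s c t x → s * (c * (s * t * x)) ≡ s * s * (c * (t * x))
  regroup = solve-∀

F-rec : ∀ k → F (k + + 2) ≡ F (k + + 1) + F k
F-rec (+ n) rewrite ℕ.+-comm n 2 | ℕ.+-comm n 1 = refl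
F-rec -[1+ zero ] = refl
F-rec -[1+ suc zero ] = refl
F-rec -[1+ suc (suc p) ] = alternate (sgn p) (fibℕ (suc p)) (fibℕ p)
  where
  alternate : ∀ s a b → s * a ≡ (- s) * (a + b) + (- (- s)) * ((a + b) + a)
  alternate = solve-∀

L-rec : ∀ k → L (k + + 2) ≡ L (k + + 1) + L k
L-rec (+ n) rewrite ℕ.+-comm n 2 | ℕ.+-comm n 1 = refl
L-rec -[1+ zero ] = refl
L-rec -[1+ suc zero ] = refl
L-rec -[1+ suc (suc p) ] = alternate (sgn p) (lucℕ (suc p)) (lucℕ p)
  where
  alternate : ∀ s a b → (- s) * a ≡ (- (- s)) * (a + b) + (- (- (- s))) * ((a + b) + a)
  alternate = solve-∀

F-neg : ∀ k → F (- k) ≡ - + 1 * (sgnℤ k * F k)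
F-neg (+ zero) = refl
F-neg (+ suc n) = negate (sgn n) (fibℕ (suc n))
  where
  negate : ∀ s x → s * x ≡ - + 1 * (- s * x)
  negate = solve-∀
F-neg -[1+ n ] = begin
  fibℕ (suc n)                                      ≡⟨ ℤ.*-identityˡ _ ⟨
  + 1 * fibℕ (suc n)                                ≡⟨ cong (_* fibℕ (suc n)) (sgn*sgn≡1 n) ⟨
  sgn n * sgn n * fibℕ (suc n)                      ≡⟨ negate (sgn n) (fibℕ (suc n)) ⟩
  - + 1 * (- sgn n * (sgn n * fibℕ (suc n)))       ∎
  where
  negate : ∀ s x → s * s * x ≡ - + 1 * (- s * (s * x))
  negate = solve-∀

L-neg : ∀ k → L (- k) ≡ + 1 * (sgnℤ k * L k)
L-neg (+ zero) = refl
L-neg (+ suc n) = sym (ℤ.*-identityˡ _)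
L-neg -[1+ n ] = begin
  lucℕ (suc n)                                      ≡⟨ ℤ.*-identityˡ _ ⟨
  + 1 * lucℕ (suc n)                                ≡⟨ cong (_* lucℕ (suc n)) (sgn*sgn≡1 (suc n)) ⟨
  sgn (suc n) * sgn (suc n) * lucℕ (suc n)          ≡⟨ regroup (sgn (suc n)) (lucℕ (suc n)) ⟩
  + 1 * (sgn (suc n) * (sgn (suc n) * lucℕ (suc n))) ∎
  where
  regroup : ∀ s x → s * s * x ≡ + 1 * (s * (s * x))
  regroup = solve-∀

theorem15 : (m : ℤ) (n : ℕ) → ℕ.NonZero n →
    ((+ 4) * sumFrom1 n (λ j → + ((n C j) ℕ.* (j / 2)) * F (+ j + m))
      ≡ (+ 2) * (+ n) * F ((+ 2) * (+ n) + m - + 1)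
        - (F ((+ 2) * (+ n) + m) + sgnℤ m * F (+ n - m)))
    × ((+ 4) * sumFrom1 n (λ j → + ((n C j) ℕ.* (j / 2)) * L (+ j + m))
      ≡ (+ 2) * (+ n) * L ((+ 2) * (+ n) + m - + 1)
        - (L ((+ 2) * (+ n) + m) - sgnℤ m * L (+ n - m)))
theorem15 m n _ =
    trans (FibonacciLike.4*sumFrom1-floorHalf F F-rec m n)
      (trans (cong (λ s → a F - b F + s) (reflect-index F (- + 1) F-neg n m)) (minus-plus (a F) (b F) _))
  , trans (FibonacciLike.4*sumFrom1-floorHalf L L-rec m n)
      (trans (cong (λ s → a L - b L + s) (reflect-index L (+ 1) L-neg n m)) (minus-minus (a L) (b L) _))
  where
  a b : (ℤ → ℤ) → ℤ
  a G = + 2 * + n * G (+ 2 * + n + m - + 1)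
  b G = G (+ 2 * + n + m)
  minus-plus : ∀ x y z → x - y + - + 1 * z ≡ x - (y + z)
  minus-plus = solve-∀
  minus-minus : ∀ x y z → x - y + + 1 * z ≡ x - (y - z)
  minus-minus = solve-∀
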